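{- Let $\mathcal{X}$ be an orthoalgebra and let $x \leq f \leq y \leq g \leq z$ be elements of $\mathcal{X}$. Regard $f$ as a morphism $x \to y$ and $g$ as a morphism $y \to z$ in the category $\mathbb{B}\mathcal{X}$, and let $g \circ f := (g \ominus y) \oplus f$ be their composite (a morphism $x \to z$). Then, in the thin category corresponding to the poset structure on the interval $[f, g] = \{t \in \mathcal{X} : f \leq t \leq g\}$, the commutative square with top arrow $f \to y$, left arrow $f \to g \circ f$, right arrow $y \to g$ and bottom arrow $g \circ f \to g$ is a pullback; equivalently, $f$ is the greatest lower bound (meet) of $y$ and $g \circ f$ in $[f, g]$.
   Context: An effect algebra $(X, 1, \oplus, (-)^\dagger)$ consists of a set $X$, an element $1$, a function $(-)^\dagger$ and a partial binary operation $\oplus$ such that: $\oplus$ is commutative (whenever $a \oplus b$ is defined so is $b \oplus a$ and they are equal); it is associative (whenever $b \oplus c$ and $a \oplus (b \oplus c)$ are defined, so are $a \oplus b$ and $(a \oplus b) \oplus c$, and they are equal); if $a \oplus 1$ is defined then $a = 0 := 1^\dagger$; and $a \oplus a^\dagger$ is always defined and equals $1$, with $a^\dagger$ the unique $b$ such that $a \oplus b = 1$. It carries a partial order: $a \leq b$ iff there is $c$ with $a \oplus c = b$, in which case $b \ominus a := c$. An orthoalgebra is an effect algebra in which $a \oplus a$ is defined only when $a = 0$. The category $\mathbb{B}\mathcal{X}$ has as objects the elements of $\mathcal{X}$, and a morphism $x \to y$ (existing only when $x \leq y$) is an element $\phi$ with $x \leq \phi \leq y$ (interval description of hom-sets); the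 composite of $\psi : y \to z$ and $\phi : x \to y$ is $(\psi \ominus y) \oplus \phi$. A poset is regarded as a thin category with a unique morphism $a \to b$ exactly when $a \leq b$. -}

module Defs where

open import Level using (Level; suc)
open import Data.Maybe using (Maybe; just)
open import Data.Product using (Σ; _×_; ∃-syntax)
open import Relation.Binary.PropositionalEquality using (_≡_)

-- An effect algebra (X, 1, ⊕, †) with the partial operation ⊕ modelled as a
-- Maybe-valued function: a ⊕ b ≡ just c means "a ⊕ b is defined and equals c".
record EffectAlgebra (ℓ : Level) : Set (suc ℓ) where
  field
    Carrier : Set ℓ
    one     : Carrier
    _⊕_     : Carrier → Carrier → Maybe Carrier
    _†      : Carrier → Carrier

  zero : Carrier
  zero = one †

  field
    ⊕-comm  : ∀ a b c → a ⊕ b ≡ just c → b ⊕ a ≡ just c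
    ⊕-assoc : ∀ a b c bc abc → b ⊕ c ≡ just bc → a ⊕ bc ≡ just abc →
              Σ Carrier (λ ab → (a ⊕ b ≡ just ab) × (ab ⊕ c ≡ just abc))
    ⊕-one   : ∀ a c → a ⊕ one ≡ just c → a ≡ zero
    ⊕-†     : ∀ a → a ⊕ (a †) ≡ just one
    †-unique : ∀ a b → a ⊕ b ≡ just one → b ≡ a †

  _≤_ : Carrier → Carrier → Set ℓ
  a ≤ b = ∃[ c ] (a ⊕ c ≡ just b)

record Orthoalgebra (ℓ : Level) : Set (suc ℓ) where
  field
    effectAlgebra : EffectAlgebra ℓ
  open EffectAlgebra effectAlgebra public
  field
    ortho : ∀ a c → a ⊕ a ≡ just c → a ≡ zero

-- With y = f ⊕ a and g = y ⊕ d, the composite is h = d ⊕ f.  If f ⊕ p = t lies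
-- below both y and h, cancellation makes p a summand of both a and d; so p ≤ y,
-- while y ⊕ d being defined forces y ⊕ p to be defined.  In an orthoalgebra an
-- element orthogonal to something above it is 0, hence t = f.
module Submission where

open import Data.Maybe using (just)
open import Data.Maybe.Properties using (just-injective)
open import Data.Product using (Σ; _×_; ∃-syntax; _,_)
open import Relation.Binary.PropositionalEquality using (_≡_; refl; sym; trans; subst)
open import Defs

module EffectAlgebraProperties {ℓ} (E : EffectAlgebra ℓ) where
  open EffectAlgebra E

  _⊥_ : Carrier → Carrier → Set ℓ
  a ⊥ b = ∃[ c ] (a ⊕ b ≡ just c)

  ⊕-assoc′ : ∀ a b c ab abc → a ⊕ b ≡ just ab → ab ⊕ c ≡ just abc →
             Σ Carrier (λ bc → (b ⊕ c ≡ just bc) × (a ⊕ bc ≡ just abc))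
  ⊕-assoc′ a b c ab abc a⊕b ab⊕c
    with ⊕-assoc c b a ab abc (⊕-comm a b ab a⊕b) (⊕-comm ab c abc ab⊕c)
  ... | cb , c⊕b , cb⊕a = cb , ⊕-comm c b cb c⊕b , ⊕-comm cb a abc cb⊕a

  -- Both a ⊕ b and a ⊕ b′ are the orthosupplement of c † ⊕ a.
  ⊕-cancelˡ : ∀ a b b′ c → a ⊕ b ≡ just c → a ⊕ b′ ≡ just c → b ≡ b′
  ⊕-cancelˡ a b b′ c a⊕b a⊕b′
    with ⊕-assoc (c †) a b c one a⊕b c†⊕c | ⊕-assoc (c †) a b′ c one a⊕b′ c†⊕c
    where c†⊕c = ⊕-comm c (c †) one (⊕-† c)
  ... | u , c†⊕a , u⊕b | u′ , c†⊕a′ , u′⊕b′ with trans (sym c†⊕a) c†⊕a′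
  ... | refl = trans (†-unique u b u⊕b) (sym (†-unique u b′ u′⊕b′))

  ⊕-identityʳ : ∀ a → a ⊕ zero ≡ just a
  ⊕-identityʳ a
    with ⊕-assoc zero a (a †) one one (⊕-† a) (⊕-comm one zero one (⊕-† one))
  ... | u , zero⊕a , u⊕a† =
    subst (λ w → a ⊕ zero ≡ just w)
      (⊕-cancelˡ (a †) u a one (⊕-comm u (a †) one u⊕a†) (⊕-comm a (a †) one (⊕-† a)))
      (⊕-comm zero a u zero⊕a)

  ≤-refl : ∀ a → a ≤ a
  ≤-refl a = zero , ⊕-identityʳ a

  ≤-trans : ∀ {a b c} → a ≤ b → b ≤ c → a ≤ c
  ≤-trans {a} {b} {c} (e , a⊕e) (e′ , b⊕e′) with ⊕-assoc′ a e e′ b c a⊕e b⊕e′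
  ... | ee′ , _ , a⊕ee′ = ee′ , a⊕ee′

  ⊥-antitoneʳ : ∀ {a b c} → c ⊥ b → a ≤ b → c ⊥ a
  ⊥-antitoneʳ {a} {b} {c} (cb , c⊕b) (e , a⊕e) with ⊕-assoc c a e b cb a⊕e c⊕b
  ... | ca , c⊕a , _ = ca , c⊕a

  ⊖-trans : ∀ {f p t q y a} → f ⊕ p ≡ just t → t ⊕ q ≡ just y → f ⊕ a ≡ just y →
            p ⊕ q ≡ just a
  ⊖-trans {f} {p} {t} {q} {y} {a} f⊕p t⊕q f⊕a with ⊕-assoc′ f p q t y f⊕p t⊕q
  ... | pq , p⊕q , f⊕pq with ⊕-cancelˡ f pq a y f⊕pq f⊕a
  ... | refl = p⊕q

module OrthoalgebraProperties {ℓ} (X : Orthoalgebra ℓ) where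
  open Orthoalgebra X
  open EffectAlgebraProperties effectAlgebra

  ≤-⊥⇒zero : ∀ {a c} → a ≤ c → c ⊥ a → a ≡ zero
  ≤-⊥⇒zero {a} {c} (b , a⊕b) (ca , c⊕a)
    with ⊕-assoc′ b a a c ca (⊕-comm a b c a⊕b) c⊕a
  ... | aa , a⊕a , _ = ortho a aa a⊕a

  interval-meet : ∀ {f a y d h t} → f ⊕ a ≡ just y → f ⊕ d ≡ just h → y ⊥ d →
                  f ≤ t → t ≤ y → t ≤ h → t ≡ f
  interval-meet {f} {a} {y} f⊕a f⊕d y⊥d (p , f⊕p) (q , t⊕q) (r , t⊕r)
    with ≤-⊥⇒zero p≤y (⊥-antitoneʳ y⊥d (r , ⊖-trans f⊕p t⊕r f⊕d))
    where
    p≤y : p ≤ y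
    p≤y = ≤-trans (q , ⊖-trans f⊕p t⊕q f⊕a) (f , ⊕-comm f a y f⊕a)
  ... | refl = just-injective (trans (sym f⊕p) (⊕-identityʳ f))

mainTheorem6 : ∀ {ℓ} (X : Orthoalgebra ℓ) → let open Orthoalgebra X in
    ∀ (x f y g z : Carrier) → x ≤ f → f ≤ y → y ≤ g → g ≤ z →
    ∀ (d : Carrier) → y ⊕ d ≡ just g →
    ∃[ h ] ((d ⊕ f ≡ just h)
    × (f ≤ h) × (h ≤ g)
    × (∀ t → f ≤ t → t ≤ g → t ≤ y → t ≤ h → t ≤ f))
mainTheorem6 X x f y g z _ (a , f⊕a) _ _ d y⊕d
  with ⊕-assoc d f a y g f⊕a (⊕-comm y d g y⊕d)
  where open Orthoalgebra X
... | h , d⊕f , h⊕a = h , d⊕f , (d , f⊕d) , (a , h⊕a) , meet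
  where
  open Orthoalgebra X
  open EffectAlgebraProperties effectAlgebra
  open OrthoalgebraProperties X
  f⊕d : f ⊕ d ≡ just h
  f⊕d = ⊕-comm d f h d⊕f
  meet : ∀ t → f ≤ t → t ≤ g → t ≤ y → t ≤ h → t ≤ f
  meet t f≤t _ t≤y t≤h =
    subst (_≤ f) (sym (interval-meet f⊕a f⊕d (g , y⊕d) f≤t t≤y t≤h)) (≤-refl f)
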